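{- Let $N\subset\mathbb R^2$ be a lattice, $\ell\ge1$ an integer, and $Q$ an $\ell$-reflexive polygon w.r.t. $N$. Then $\ell$ is odd.
   Context: A lattice in $\mathbb R^2$ is a discrete additive subgroup spanning $\mathbb R^2$; $M=\{\mathbf x:\langle\mathbf x,\mathbf n\rangle\in\mathbb Z\ \forall\mathbf n\in N\}$ its dual. An $\ell$-reflexive polygon w.r.t. $N$ is a convex polygon with vertices in $N$, $\mathbf 0$ in its interior, primitive vertices (nonzero lattice points with no other lattice point on the segment to $\mathbf 0$), such that every edge $F$ lies on a line $\{\mathbf y:\langle\boldsymbol\eta_F,\mathbf y\rangle=-\ell\}$ with $\boldsymbol\eta_F\in M$ primitive. -}

module Defs where

open import Data.Nat as ℕ using (ℕ; suc; _%_; _≤_)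
open import Data.Nat.DivMod using (m%n<n)
open import Data.Nat.GCD as G using ()
open import Data.Integer as ℤ using (ℤ; +_; -_; _-_; _*_; _+_; ∣_∣)
open import Data.Fin using (Fin; toℕ; fromℕ<)
open import Data.Product using (_×_; _,_; proj₁; proj₂; ∃)
open import Relation.Binary.PropositionalEquality using (_≡_)

-- The lattice N is identified with ℤ² (choice of a basis); its dual M is
-- then ℤ² with the standard pairing ⟨x , y⟩ = x₁y₁ + x₂y₂.
ℤ² : Set
ℤ² = ℤ × ℤ

⟨_,_⟩ : ℤ² → ℤ² → ℤ
⟨ (a , b) , (c , d) ⟩ = a * c + b * d

_-²_ : ℤ² → ℤ² → ℤ²
(a , b) -² (c , d) = (a - c , b - d)

det : ℤ² → ℤ² → ℤ
det (a , b) (c , d) = a * d - b * c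

Primitive : ℤ² → Set
Primitive (a , b) = G.gcd ∣ a ∣ ∣ b ∣ ≡ 1

next : ∀ {k} → Fin (suc k) → Fin (suc k)
next {k} i = fromℕ< (m%n<n (suc (toℕ i)) (suc k))

-- A convex polygon with vertices v 0, …, v (n-1) (n = suc k) listed in
-- counter-clockwise cyclic order; edges are [v i, v (next i)].
record ConvexPolygon (k : ℕ) (v : Fin (suc k) → ℤ²) : Set where
  field
    atLeast3 : 2 ≤ k
    convex : ∀ i j → ℤ.0ℤ ℤ.≤ det (v (next i) -² v i) (v j -² v i)
    -- strict turn at every vertex: each v i is a genuine vertex
    strictTurn : ∀ i → ℤ.0ℤ ℤ.< det (v (next i) -² v i) (v (next (next i)) -² v (next i))

ZeroInterior : ∀ {k} → (Fin (suc k) → ℤ²) → Set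
ZeroInterior v = ∀ i → ℤ.0ℤ ℤ.< det (v i) (v (next i))

record Reflexive (ℓ : ℕ) (k : ℕ) (v : Fin (suc k) → ℤ²) : Set where
  field
    polygon : ConvexPolygon k v
    interior : ZeroInterior v
    primitiveVertices : ∀ i → Primitive (v i)
    edgeNormal : ∀ i → ∃ λ (η : ℤ²) → Primitive η
                   × ⟨ η , v i ⟩ ≡ - (+ ℓ) × ⟨ η , v (next i) ⟩ ≡ - (+ ℓ)

module Submission where

-- Write each edge as v (i+1) = v i + Lᵢ J ηᵢ and each corner as η (i+1) = ηᵢ + Aᵢ J v (i+1),
-- where J is the quarter turn; Lᵢ > 0 because 0 is interior and Aᵢ > 0 because every vertex is
-- a genuine corner. If ℓ were even, then ⟨ η , v ⟩ = -ℓ would force v ≡ J η (mod 2) for the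
-- primitive η and v, so all Lᵢ and Aᵢ would be even, hence at least 2. Expanding two steps gives
-- ⟨ η (i+2) , v i ⟩ + ℓ = ℓ (a t + b t + b s - a t b s) with (a , t) = (Aᵢ , Lᵢ) and
-- (b , s) = (A (i+1) , L (i+1)), which is negative once a, b, s, t ≥ 2: this contradicts convexity.

open import Defs
open import Data.Nat using (ℕ; suc; _≤_; _%_)
open import Data.Fin using (Fin)
open import Relation.Binary.PropositionalEquality using (_≡_)

import Data.Nat as ℕ
open import Data.Fin using (zero)
open import Data.Nat.DivMod using (m%n<n)
open import Data.Nat.Properties using (m≤m+n; ≤-trans; ≤-reflexive)
open import Data.Nat.Divisibility using (m%n≡0⇒n∣m; ∣⇒≤)
open import Data.Nat.Coprimality using (gcd≡1⇒coprime; coprime-Bézout)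
open import Data.Nat.GCD using (module Bézout)
import Data.Nat.Tactic.RingSolver as ℕ-Solver
open import Data.Integer.Base as ℤ
  using (ℤ; +_; -[1+_]; +[1+_]; 0ℤ; 1ℤ; -1ℤ; _+_; _-_; _*_; -_; +≤+; +<+;
         positive; nonNegative)
open import Data.Integer.Properties
  using (*-identityˡ; *-identityʳ; *-assoc; +-identityˡ; -1*i≡-i; pos-*; 0≤i-j⇒j≤i;
         <⇒≱; <⇒≤; *-monoˡ-<-pos; *-cancelʳ-<-nonNeg; *-cancelʳ-≤-pos)
open import Data.Integer.DivMod using (_%ℕ_; _/ℕ_; n%ℕd<d; a≡a%ℕn+[a/ℕn]*n)
open import Data.Integer.Divisibility.Signed
  using (_∣_; divides; ∣ᵤ⇒∣; ∣⇒∣ᵤ; ∣m∣n⇒∣m+n; ∣m∣n⇒∣m-n; ∣m⇒∣-m;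
         ∣n⇒∣m*n; ∣m⇒∣m*n)
open import Data.Integer.Tactic.RingSolver using (solve-∀; solve)
open import Data.Product using (_×_; _,_; proj₁; proj₂; ∃)
open import Data.Sum using (_⊎_; inj₁; inj₂)
open import Data.Empty using (⊥; ⊥-elim)
open import Data.List using ([]; _∷_)
open import Relation.Nullary using (¬_)
open import Relation.Binary.PropositionalEquality
  using (refl; sym; trans; cong; cong₂; subst; subst₂; module ≡-Reasoning)
open ≡-Reasoning

infixl 6 _+²_
infixr 7 _*²_
infix 4 _∣²_

_+²_ : ℤ² → ℤ² → ℤ²
(a , b) +² (c , d) = (a + c , b + d)

_*²_ : ℤ → ℤ² → ℤ²
t *² (a , b) = (t * a , t * b)

J : ℤ² → ℤ²
J (a , b) = (b , - a)

_∣²_ : ℤ → ℤ² → Set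
c ∣² (a , b) = (c ∣ a) × (c ∣ b)

Unimodular : ℤ² → Set
Unimodular x = ∃ λ ρ → ⟨ ρ , x ⟩ ≡ 1ℤ

⟨,⟩-comm : ∀ x y → ⟨ x , y ⟩ ≡ ⟨ y , x ⟩
⟨,⟩-comm (a , b) (c , d) = identity a b c d
  where identity : ∀ a b c d → a * c + b * d ≡ c * a + d * b
        identity = solve-∀

⟨,⟩-distrib-‐² : ∀ x y z → ⟨ x , y -² z ⟩ ≡ ⟨ x , y ⟩ - ⟨ x , z ⟩
⟨,⟩-distrib-‐² (a , b) (c , d) (e , f) = identity a b c d e f
  where identity : ∀ a b c d e f → a * (c - e) + b * (d - f) ≡ (a * c + b * d) - (a * e + b * f)
        identity = solve-∀

⟨,⟩-linear : ∀ x s y t z →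
             ⟨ x , s *² y +² t *² z ⟩ ≡ s * ⟨ x , y ⟩ + t * ⟨ x , z ⟩
⟨,⟩-linear (a , b) s (c , d) t (e , f) = identity a b s c d t e f
  where identity : ∀ a b s c d t e f → a * (s * c + t * e) + b * (s * d + t * f)
                                       ≡ s * (a * c + b * d) + t * (a * e + b * f)
        identity = solve-∀

⟨,⟩-J : ∀ x y → ⟨ J x , J y ⟩ ≡ ⟨ x , y ⟩
⟨,⟩-J (a , b) (c , d) = identity a b c d
  where identity : ∀ a b c d → b * d + - a * - c ≡ a * c + b * d
        identity = solve-∀

⟨,⟩-+²-J : ∀ y t z x → ⟨ y +² t *² J z , x ⟩ ≡ ⟨ y , x ⟩ + t * det x z
⟨,⟩-+²-J (c , d) t (e , f) (a , b) = identity a b c d e f t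
  where identity : ∀ a b c d e f t →
                   (c + t * f) * a + (d + t * - e) * b ≡ (c * a + d * b) + t * (a * f - b * e)
        identity = solve-∀

det-self : ∀ x → det x x ≡ 0ℤ
det-self (a , b) = identity a b
  where identity : ∀ a b → a * b - b * a ≡ 0ℤ
        identity = solve-∀

det-antisym : ∀ x y → det x y ≡ - det y x
det-antisym (a , b) (c , d) = identity a b c d
  where identity : ∀ a b c d → a * d - b * c ≡ - (c * b - d * a)
        identity = solve-∀

det-+²-J : ∀ x y t z → det x (y +² t *² J z) ≡ det x y - t * ⟨ z , x ⟩
det-+²-J (a , b) (c , d) t (e , f) = identity a b c d e f t
  where identity : ∀ a b c d e f t →
                   a * (d + t * - e) - b * (c + t * f) ≡ (a * d - b * c) - t * (e * a + f * b)
        identity = solve-∀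

det-‐²-J : ∀ x t y w → det ((x +² t *² J y) -² x) w ≡ t * ⟨ y , w ⟩
det-‐²-J (a , b) t (c , d) (e , f) = identity a b t c d e f
  where identity : ∀ a b t c d e f →
                   (a + t * d - a) * f - (b + t * - c - b) * e ≡ t * (c * e + d * f)
        identity = solve-∀

cramer : ∀ ρ η d → ⟨ ρ , η ⟩ *² d ≡ ⟨ η , d ⟩ *² ρ +² det d ρ *² J η
cramer (r , s) (p , q) (a , b) = cong₂ _,_ (first r s p q a b) (second r s p q a b)
  where first : ∀ r s p q a b → (r * p + s * q) * a ≡ (p * a + q * b) * r + (a * s - b * r) * q
        first = solve-∀
        second : ∀ r s p q a b → (r * p + s * q) * b ≡ (p * a + q * b) * s + (a * s - b * r) * - p
        second = solve-∀

*²-identityˡ : ∀ x → 1ℤ *² x ≡ x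
*²-identityˡ (a , b) = cong₂ _,_ (*-identityˡ a) (*-identityˡ b)

*²-+²-regroup : ∀ m ρ s t w → m *² ρ +² s *² w ≡ (m *² ρ +² t *² w) +² (s - t) *² w
*²-+²-regroup m (a , b) s t (c , d) = cong₂ _,_ (identity m a s t c) (identity m b s t d)
  where identity : ∀ m a s t c → m * a + s * c ≡ m * a + t * c + (s - t) * c
        identity = solve-∀

*²-+²-‐² : ∀ s x t y → (s *² x +² t *² y) -² y ≡ s *² x +² (t - 1ℤ) *² y
*²-+²-‐² s (a , b) t (c , d) = cong₂ _,_ (identity s a t c) (identity s b t d)
  where identity : ∀ s a t c → s * a + t * c - c ≡ s * a + (t - 1ℤ) * c
        identity = solve-∀

edge-shift : ∀ x t y → ((x +² t *² J y) -² J y) -² (x -² J y) ≡ t *² J y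
edge-shift (a , b) t (c , d) = cong₂ _,_ (first a t d) (second b t c)
  where first : ∀ a t d → a + t * d - d - (a - d) ≡ t * d
        first = solve-∀
        second : ∀ b t c → b + t * - c - - c - (b - - c) ≡ t * - c
        second = solve-∀

corner-shift : ∀ x y a → (x -² J (y +² a *² J x)) -² (x -² J y) ≡ a *² x
corner-shift (e , f) (c , d) a = cong₂ _,_ (first e d a) (second f c a)
  where first : ∀ e d a → e - (d + a * - e) - (e - d) ≡ a * e
        first = solve-∀
        second : ∀ f c a → f - - (c + a * f) - (f - - c) ≡ a * f
        second = solve-∀

abs-as-multiple : ∀ a → ∃ λ ε → + ℤ.∣ a ∣ ≡ ε * a
abs-as-multiple (+ n)    = 1ℤ , sym (*-identityˡ (+ n))
abs-as-multiple -[1+ n ] = -1ℤ , sym (-1*i≡-i -[1+ n ])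

1+yn≡xm⇒xm-yn≡1 : ∀ x m y n → 1 ℕ.+ y ℕ.* n ≡ x ℕ.* m →
                  + x * + m - + y * + n ≡ 1ℤ
1+yn≡xm⇒xm-yn≡1 x m y n eq = begin
  + x * + m - + y * + n          ≡⟨ cong₂ _-_ (pos-* x m) (pos-* y n) ⟨
  + (x ℕ.* m) - + (y ℕ.* n)      ≡⟨ cong (λ k → + k - + (y ℕ.* n)) eq ⟨
  1ℤ + + (y ℕ.* n) - + (y ℕ.* n) ≡⟨ cancel (+ (y ℕ.* n)) ⟩
  1ℤ                             ∎
  where cancel : ∀ k → 1ℤ + k - k ≡ 1ℤ
        cancel = solve-∀

bézout-ℤ : ∀ {m n} → Bézout.Identity 1 m n →
           ∃ λ r → ∃ λ s → r * + m + s * + n ≡ 1ℤ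
bézout-ℤ {m} {n} (Bézout.+- x y eq) =
  + x , - + y , trans (rearrange (+ x) (+ m) (+ y) (+ n)) (1+yn≡xm⇒xm-yn≡1 x m y n eq)
  where rearrange : ∀ x m y n → x * m + - y * n ≡ x * m - y * n
        rearrange = solve-∀
bézout-ℤ {m} {n} (Bézout.-+ x y eq) =
  - + x , + y , trans (rearrange (+ x) (+ m) (+ y) (+ n)) (1+yn≡xm⇒xm-yn≡1 y n x m eq)
  where rearrange : ∀ x m y n → - x * m + y * n ≡ y * n - x * m
        rearrange = solve-∀

primitive⇒unimodular : ∀ {x} → Primitive x → Unimodular x
primitive⇒unimodular {a , b} gcd≡1
  with ε , ∣a∣≡εa ← abs-as-multiple a | δ , ∣b∣≡δb ← abs-as-multiple b
     | r , s , bézout ← bézout-ℤ (coprime-Bézout (gcd≡1⇒coprime gcd≡1))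
  = (r * ε , s * δ) , (begin
      r * ε * a + s * δ * b
        ≡⟨ cong₂ _+_ (*-assoc r ε a) (*-assoc s δ b) ⟩
      r * (ε * a) + s * (δ * b)
        ≡⟨ cong₂ (λ u w → r * u + s * w) ∣a∣≡εa ∣b∣≡δb ⟨
      r * + ℤ.∣ a ∣ + s * + ℤ.∣ b ∣
        ≡⟨ bézout ⟩
      1ℤ
        ∎)

unimodular-J : ∀ {x} → Unimodular x → Unimodular (J x)
unimodular-J {x} (ρ , ρx≡1) = J ρ , trans (⟨,⟩-J ρ x) ρx≡1

basis-decomposition : ∀ ρ η → ⟨ ρ , η ⟩ ≡ 1ℤ →
                      ∀ d → d ≡ ⟨ η , d ⟩ *² ρ +² det d ρ *² J η
basis-decomposition ρ η ρη≡1 d = begin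
  d                                ≡⟨ *²-identityˡ d ⟨
  1ℤ *² d                          ≡⟨ cong (_*² d) ρη≡1 ⟨
  ⟨ ρ , η ⟩ *² d                   ≡⟨ cramer ρ η d ⟩
  ⟨ η , d ⟩ *² ρ +² det d ρ *² J η ∎

same-level⇒J-translate : ∀ {η x y} → Unimodular η → ⟨ η , x ⟩ ≡ ⟨ η , y ⟩ →
                         ∃ λ t → y ≡ x +² t *² J η
same-level⇒J-translate {η} {x} {y} (ρ , ρη≡1) ηx≡ηy = t , (begin
  y
    ≡⟨ basis-decomposition ρ η ρη≡1 y ⟩
  ⟨ η , y ⟩ *² ρ +² det y ρ *² J η
    ≡⟨ cong (λ m → m *² ρ +² det y ρ *² J η) ηx≡ηy ⟨
  ⟨ η , x ⟩ *² ρ +² det y ρ *² J η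
    ≡⟨ *²-+²-regroup (⟨ η , x ⟩) ρ (det y ρ) (det x ρ) (J η) ⟩
  ⟨ η , x ⟩ *² ρ +² det x ρ *² J η +² t *² J η
    ≡⟨ cong (_+² t *² J η) (basis-decomposition ρ η ρη≡1 x) ⟨
  x +² t *² J η
    ∎)
  where t : ℤ
        t = det y ρ - det x ρ

∣²-‐² : ∀ {c x y} → c ∣² x → c ∣² y → c ∣² x -² y
∣²-‐² {x = _ , _} {_ , _} (c∣a , c∣b) (c∣a′ , c∣b′) =
  ∣m∣n⇒∣m-n c∣a c∣a′ , ∣m∣n⇒∣m-n c∣b c∣b′

∣²-combination : ∀ {c s t} x y → c ∣ s → c ∣ t → c ∣² s *² x +² t *² y
∣²-combination (a , b) (e , f) c∣s c∣t =
  ∣m∣n⇒∣m+n (∣m⇒∣m*n a c∣s) (∣m⇒∣m*n e c∣t) ,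
  ∣m∣n⇒∣m+n (∣m⇒∣m*n b c∣s) (∣m⇒∣m*n f c∣t)

∣²-*²-unimodular : ∀ {c t x} → Unimodular x → c ∣² t *² x → c ∣ t
∣²-*²-unimodular {c} {t} {a , b} ((r , s) , ra+sb≡1) (c∣ta , c∣tb) =
  subst (c ∣_) combination (∣m∣n⇒∣m+n (∣n⇒∣m*n r c∣ta) (∣n⇒∣m*n s c∣tb))
  where
  combination : r * (t * a) + s * (t * b) ≡ t
  combination = begin
    r * (t * a) + s * (t * b) ≡⟨ solve (r ∷ s ∷ t ∷ a ∷ b ∷ []) ⟩
    t * (r * a + s * b)       ≡⟨ cong (t *_) ra+sb≡1 ⟩
    t * 1ℤ                    ≡⟨ *-identityʳ t ⟩
    t                         ∎

2∤1 : ¬ (+ 2 ∣ 1ℤ)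
2∤1 2∣1 with ∣⇒≤ (∣⇒∣ᵤ 2∣1)
... | ℕ.s≤s ()

2∣t⊎2∣t-1 : ∀ t → + 2 ∣ t ⊎ + 2 ∣ t - 1ℤ
2∣t⊎2∣t-1 t with t %ℕ 2 | n%ℕd<d t 2 | a≡a%ℕn+[a/ℕn]*n t 2
... | 0           | _                 | t≡q*2   =
  inj₁ (divides (t /ℕ 2) (trans t≡q*2 (+-identityˡ _)))
... | 1           | _                 | t≡1+q*2 =
  inj₂ (divides (t /ℕ 2) (trans (cong (_- 1ℤ) t≡1+q*2) (cancel (t /ℕ 2 * + 2))))
  where cancel : ∀ k → 1ℤ + k - 1ℤ ≡ k
        cancel = solve-∀
... | suc (suc _) | ℕ.s≤s (ℕ.s≤s ()) | _

2∣pairing⇒2∣²[v-Jη] : ∀ {η v} → Unimodular η → Unimodular v →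
                      + 2 ∣ ⟨ η , v ⟩ → + 2 ∣² v -² J η
2∣pairing⇒2∣²[v-Jη] {η} {v} (ρ , ρη≡1) (σ , σv≡1) 2∣ηv =
  subst (+ 2 ∣²_) v-Jη-decomposition (∣²-combination ρ (J η) 2∣ηv 2∣t-1)
  where
  t : ℤ
  t = det v ρ

  v-decomposition : v ≡ ⟨ η , v ⟩ *² ρ +² t *² J η
  v-decomposition = basis-decomposition ρ η ρη≡1 v

  v-Jη-decomposition : ⟨ η , v ⟩ *² ρ +² (t - 1ℤ) *² J η ≡ v -² J η
  v-Jη-decomposition =
    trans (sym (*²-+²-‐² (⟨ η , v ⟩) ρ t (J η))) (cong (_-² J η) (sym v-decomposition))

  σv-expansion : ⟨ η , v ⟩ * ⟨ σ , ρ ⟩ + t * ⟨ σ , J η ⟩ ≡ 1ℤ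
  σv-expansion = begin
    ⟨ η , v ⟩ * ⟨ σ , ρ ⟩ + t * ⟨ σ , J η ⟩
      ≡⟨ ⟨,⟩-linear σ (⟨ η , v ⟩) ρ t (J η) ⟨
    ⟨ σ , ⟨ η , v ⟩ *² ρ +² t *² J η ⟩
      ≡⟨ cong (λ w → ⟨ σ , w ⟩) v-decomposition ⟨
    ⟨ σ , v ⟩
      ≡⟨ σv≡1 ⟩
    1ℤ
      ∎

  2∣t-1 : + 2 ∣ t - 1ℤ
  2∣t-1 with 2∣t⊎2∣t-1 t
  ... | inj₂ 2∣t-1 = 2∣t-1
  ... | inj₁ 2∣t   = ⊥-elim (2∤1 (subst (+ 2 ∣_) σv-expansion
                       (∣m∣n⇒∣m+n (∣m⇒∣m*n _ 2∣ηv) (∣m⇒∣m*n _ 2∣t))))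

0≤i∧0≤j⇒0≤i*j : ∀ {i j} → 0ℤ ℤ.≤ i → 0ℤ ℤ.≤ j → 0ℤ ℤ.≤ i * j
0≤i∧0≤j⇒0≤i*j {+ m} {+ n} _ _ = subst (0ℤ ℤ.≤_) (pos-* m n) (+≤+ ℕ.z≤n)

even∧positive⇒2≤ : ∀ {i} → + 2 ∣ i → 0ℤ ℤ.< i → + 2 ℤ.≤ i
even∧positive⇒2≤ (divides (+ 0)     refl) (+<+ ())
even∧positive⇒2≤ (divides +[1+ _ ] refl) _ = +≤+ (ℕ.s≤s (ℕ.s≤s ℕ.z≤n))
even∧positive⇒2≤ (divides -[1+ _ ] refl) ()

-- With a = 2 + a′ and so on, the difference of the two sides is 1 plus a polynomial
-- in a′, b′, s′, t′ with nonnegative coefficients.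
ℕ-product-bound : ∀ {a b s t} → 2 ≤ a → 2 ≤ b → 2 ≤ s → 2 ≤ t →
                  a ℕ.* t ℕ.+ b ℕ.* t ℕ.+ b ℕ.* s ℕ.< a ℕ.* t ℕ.* (b ℕ.* s)
ℕ-product-bound {suc (suc a′)} {suc (suc b′)} {suc (suc s′)} {suc (suc t′)}
                (ℕ.s≤s (ℕ.s≤s ℕ.z≤n)) (ℕ.s≤s (ℕ.s≤s ℕ.z≤n))
                (ℕ.s≤s (ℕ.s≤s ℕ.z≤n)) (ℕ.s≤s (ℕ.s≤s ℕ.z≤n)) =
  ≤-trans (m≤m+n _ _) (≤-reflexive (certificate a′ b′ s′ t′))
  where
  certificate : ∀ a b s t →
    suc ((2 ℕ.+ a) ℕ.* (2 ℕ.+ t) ℕ.+ (2 ℕ.+ b) ℕ.* (2 ℕ.+ t)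
         ℕ.+ (2 ℕ.+ b) ℕ.* (2 ℕ.+ s))
      ℕ.+ ((2 ℕ.+ t) ℕ.* (b ℕ.+ 2 ℕ.* s ℕ.+ b ℕ.* s)
           ℕ.+ (2 ℕ.+ b) ℕ.* (2 ℕ.+ s) ℕ.* t
           ℕ.+ (1 ℕ.+ a ℕ.* (2 ℕ.+ t)) ℕ.* (3 ℕ.+ 2 ℕ.* b ℕ.+ 2 ℕ.* s ℕ.+ b ℕ.* s))
    ≡ (2 ℕ.+ a) ℕ.* (2 ℕ.+ t) ℕ.* ((2 ℕ.+ b) ℕ.* (2 ℕ.+ s))
  certificate = ℕ-Solver.solve-∀

product-bound : ∀ {a b s t} → + 2 ℤ.≤ a → + 2 ℤ.≤ b → + 2 ℤ.≤ s → + 2 ℤ.≤ t →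
                a * t + b * t + b * s ℤ.< a * t * (b * s)
product-bound {+ a} {+ b} {+ s} {+ t} (+≤+ 2≤a) (+≤+ 2≤b) (+≤+ 2≤s) (+≤+ 2≤t) =
  subst₂ ℤ._<_ lhs rhs (+<+ (ℕ-product-bound 2≤a 2≤b 2≤s 2≤t))
  where
  lhs : + (a ℕ.* t ℕ.+ b ℕ.* t ℕ.+ b ℕ.* s) ≡ + a * + t + + b * + t + + b * + s
  lhs = cong₂ _+_ (cong₂ _+_ (pos-* a t) (pos-* b t)) (pos-* b s)
  rhs : + (a ℕ.* t ℕ.* (b ℕ.* s)) ≡ + a * + t * (+ b * + s)
  rhs = trans (pos-* (a ℕ.* t) (b ℕ.* s)) (cong₂ _*_ (pos-* a t) (pos-* b s))

module ReflexivePolygon {ℓ k : ℕ} {v : Fin (suc k) → ℤ²} (R : Reflexive ℓ k v) where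

  open Reflexive R
  open ConvexPolygon polygon using (convex; strictTurn)

  η : Fin (suc k) → ℤ²
  η i = proj₁ (edgeNormal i)

  η-unimodular : ∀ i → Unimodular (η i)
  η-unimodular i = primitive⇒unimodular (proj₁ (proj₂ (edgeNormal i)))

  v-unimodular : ∀ i → Unimodular (v i)
  v-unimodular i = primitive⇒unimodular (primitiveVertices i)

  η-level : ∀ i → ⟨ η i , v i ⟩ ≡ - + ℓ
  η-level i = proj₁ (proj₂ (proj₂ (edgeNormal i)))

  η-level-next : ∀ i → ⟨ η i , v (next i) ⟩ ≡ - + ℓ
  η-level-next i = proj₂ (proj₂ (proj₂ (edgeNormal i)))

  edge : ∀ i → ∃ λ t → v (next i) ≡ v i +² t *² J (η i)
  edge i = same-level⇒J-translate (η-unimodular i) (trans (η-level i) (sym (η-level-next i)))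

  len : Fin (suc k) → ℤ
  len i = proj₁ (edge i)

  v-next : ∀ i → v (next i) ≡ v i +² len i *² J (η i)
  v-next i = proj₂ (edge i)

  corner : ∀ i → ∃ λ a → η (next i) ≡ η i +² a *² J (v (next i))
  corner i = same-level⇒J-translate (v-unimodular (next i)) (begin
    ⟨ v (next i) , η i ⟩        ≡⟨ ⟨,⟩-comm (v (next i)) (η i) ⟩
    ⟨ η i , v (next i) ⟩        ≡⟨ trans (η-level-next i) (sym (η-level (next i))) ⟩
    ⟨ η (next i) , v (next i) ⟩ ≡⟨ ⟨,⟩-comm (η (next i)) (v (next i)) ⟩
    ⟨ v (next i) , η (next i) ⟩ ∎)

  bend : Fin (suc k) → ℤ
  bend i = proj₁ (corner i)

  η-next : ∀ i → η (next i) ≡ η i +² bend i *² J (v (next i))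
  η-next i = proj₂ (corner i)

  det-v-next : ∀ i x → det x (v (next i)) ≡ det x (v i) - len i * ⟨ η i , x ⟩
  det-v-next i x = trans (cong (det x) (v-next i)) (det-+²-J x (v i) (len i) (η i))

  η-next-pairing : ∀ i x →
                   ⟨ η (next i) , x ⟩ ≡ ⟨ η i , x ⟩ + bend i * det x (v (next i))
  η-next-pairing i x =
    trans (cong (λ y → ⟨ y , x ⟩) (η-next i)) (⟨,⟩-+²-J (η i) (bend i) (v (next i)) x)

  edge-det : ∀ i x y →
             det (v (next i) -² v i) (x -² y) ≡ len i * (⟨ η i , x ⟩ - ⟨ η i , y ⟩)
  edge-det i x y = begin
    det (v (next i) -² v i) (x -² y)
      ≡⟨ cong (λ u → det (u -² v i) (x -² y)) (v-next i) ⟩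
    det ((v i +² len i *² J (η i)) -² v i) (x -² y)
      ≡⟨ det-‐²-J (v i) (len i) (η i) (x -² y) ⟩
    len i * ⟨ η i , x -² y ⟩
      ≡⟨ cong (len i *_) (⟨,⟩-distrib-‐² (η i) x y) ⟩
    len i * (⟨ η i , x ⟩ - ⟨ η i , y ⟩)
      ∎

  det-consecutive : ∀ i → det (v i) (v (next i)) ≡ len i * + ℓ
  det-consecutive i = begin
    det (v i) (v (next i))
      ≡⟨ det-v-next i (v i) ⟩
    det (v i) (v i) - len i * ⟨ η i , v i ⟩
      ≡⟨ cong₂ (λ d e → d - len i * e) (det-self (v i)) (η-level i) ⟩
    0ℤ - len i * - + ℓ
      ≡⟨ identity (len i) (+ ℓ) ⟩
    len i * + ℓ
      ∎
    where identity : ∀ t l → 0ℤ - t * - l ≡ t * l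
          identity = solve-∀

  len-positive : ∀ i → 0ℤ ℤ.< len i
  len-positive i = *-cancelʳ-<-nonNeg (+ ℓ) (subst (0ℤ ℤ.<_) (det-consecutive i) (interior i))

  level-bound : ∀ i j → 0ℤ ℤ.≤ ⟨ η i , v j ⟩ + + ℓ
  level-bound i j = *-cancelʳ-≤-pos 0ℤ _ (len i) {{positive (len-positive i)}}
                      (subst (0ℤ ℤ.≤_) convex-det (convex i j))
    where
    convex-det : det (v (next i) -² v i) (v j -² v i) ≡ (⟨ η i , v j ⟩ + + ℓ) * len i
    convex-det = begin
      det (v (next i) -² v i) (v j -² v i)
        ≡⟨ edge-det i (v j) (v i) ⟩
      len i * (⟨ η i , v j ⟩ - ⟨ η i , v i ⟩)
        ≡⟨ cong (λ e → len i * (⟨ η i , v j ⟩ - e)) (η-level i) ⟩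
      len i * (⟨ η i , v j ⟩ - - + ℓ)
        ≡⟨ identity (len i) (⟨ η i , v j ⟩) (+ ℓ) ⟩
      (⟨ η i , v j ⟩ + + ℓ) * len i
        ∎
      where identity : ∀ t e l → t * (e - - l) ≡ (e + l) * t
            identity = solve-∀

  level-drop : ∀ i → ⟨ η i , v (next (next i)) ⟩ - ⟨ η i , v (next i) ⟩
                      ≡ bend i * (len (next i) * + ℓ)
  level-drop i = begin
    E - ⟨ η i , v (next i) ⟩
      ≡⟨ cong (λ e → E - e) (trans same-level (η-next-pairing i (v (next (next i))))) ⟩
    E - (E + bend i * det (v (next (next i))) (v (next i)))
      ≡⟨ cong (λ d → E - (E + bend i * d)) det-flip ⟩
    E - (E + bend i * - (len (next i) * + ℓ))
      ≡⟨ identity E (bend i) (len (next i) * + ℓ) ⟩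
    bend i * (len (next i) * + ℓ)
      ∎
    where
    E : ℤ
    E = ⟨ η i , v (next (next i)) ⟩
    same-level : ⟨ η i , v (next i) ⟩ ≡ ⟨ η (next i) , v (next (next i)) ⟩
    same-level = trans (η-level-next i) (sym (η-level-next (next i)))
    det-flip : det (v (next (next i))) (v (next i)) ≡ - (len (next i) * + ℓ)
    det-flip = trans (det-antisym (v (next (next i))) (v (next i))) (cong -_ (det-consecutive (next i)))
    identity : ∀ e b d → e - (e + b * - d) ≡ b * d
    identity = solve-∀

  bend-positive : ∀ i → 0ℤ ℤ.< bend i
  bend-positive i = *-cancelʳ-<-nonNeg (len i * (len (next i) * + ℓ)) {{nonNegative product-nonneg}}
                      (subst (0ℤ ℤ.<_) turn-det (strictTurn i))
    where
    turn-det : det (v (next i) -² v i) (v (next (next i)) -² v (next i))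
               ≡ bend i * (len i * (len (next i) * + ℓ))
    turn-det = trans (edge-det i (v (next (next i))) (v (next i)))
                     (trans (cong (len i *_) (level-drop i))
                            (identity (len i) (bend i) (len (next i) * + ℓ)))
      where identity : ∀ t b d → t * (b * d) ≡ b * (t * d)
            identity = solve-∀
    product-nonneg : 0ℤ ℤ.≤ len i * (len (next i) * + ℓ)
    product-nonneg = 0≤i∧0≤j⇒0≤i*j (<⇒≤ (len-positive i))
                       (0≤i∧0≤j⇒0≤i*j (<⇒≤ (len-positive (next i))) (+≤+ ℕ.z≤n))

  second-neighbour-level : ∀ i →
    ⟨ η (next (next i)) , v i ⟩ + + ℓ
      ≡ + ℓ * (bend i * len i + bend (next i) * len i + bend (next i) * len (next i))
        - + ℓ * (bend i * len i * (bend (next i) * len (next i)))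
  second-neighbour-level i =
    substitute (+ ℓ) (bend i) (len i) (bend (next i)) (len (next i))
               (η-next-pairing (next i) (v i)) det-second η-next-at-i
    where
    η-next-at-i : ⟨ η (next i) , v i ⟩ ≡ - + ℓ + bend i * (len i * + ℓ)
    η-next-at-i = trans (η-next-pairing i (v i))
                        (cong₂ (λ e d → e + bend i * d) (η-level i) (det-consecutive i))
    det-second : det (v i) (v (next (next i))) ≡ len i * + ℓ - len (next i) * ⟨ η (next i) , v i ⟩
    det-second = trans (det-v-next (next i) (v i))
                       (cong (_- len (next i) * ⟨ η (next i) , v i ⟩) (det-consecutive i))
    substitute : ∀ {E P D} l a t b s →
                 E ≡ P + b * D → D ≡ t * l - s * P → P ≡ - l + a * (t * l) →
                 E + l ≡ l * (a * t + b * t + b * s) - l * (a * t * (b * s))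
    substitute l a t b s refl refl refl = solve (l ∷ a ∷ t ∷ b ∷ s ∷ [])

  module _ (2∣ℓ : + 2 ∣ + ℓ) where

    2∣level : ∀ {x} → x ≡ - + ℓ → + 2 ∣ x
    2∣level x≡-ℓ = subst (+ 2 ∣_) (sym x≡-ℓ) (∣m⇒∣-m 2∣ℓ)

    2∣²v-Jη : ∀ i → + 2 ∣² v i -² J (η i)
    2∣²v-Jη i =
      2∣pairing⇒2∣²[v-Jη] (η-unimodular i) (v-unimodular i) (2∣level (η-level i))

    2∣²v-next-Jη : ∀ i → + 2 ∣² v (next i) -² J (η i)
    2∣²v-next-Jη i =
      2∣pairing⇒2∣²[v-Jη] (η-unimodular i) (v-unimodular (next i)) (2∣level (η-level-next i))

    len-even : ∀ i → + 2 ∣ len i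
    len-even i = ∣²-*²-unimodular (unimodular-J (η-unimodular i))
      (subst (+ 2 ∣²_) difference (∣²-‐² (2∣²v-next-Jη i) (2∣²v-Jη i)))
      where
      difference : (v (next i) -² J (η i)) -² (v i -² J (η i)) ≡ len i *² J (η i)
      difference = trans (cong (λ u → (u -² J (η i)) -² (v i -² J (η i))) (v-next i))
                         (edge-shift (v i) (len i) (η i))

    bend-even : ∀ i → + 2 ∣ bend i
    bend-even i = ∣²-*²-unimodular (v-unimodular (next i))
      (subst (+ 2 ∣²_) difference (∣²-‐² (2∣²v-Jη (next i)) (2∣²v-next-Jη i)))
      where
      difference : (v (next i) -² J (η (next i))) -² (v (next i) -² J (η i))
                   ≡ bend i *² v (next i)
      difference = trans (cong (λ y → (v (next i) -² J y) -² (v (next i) -² J (η i))) (η-next i))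
                         (corner-shift (v (next i)) (η i) (bend i))

    second-neighbour-violates-convexity : 0ℤ ℤ.< + ℓ → Fin (suc k) → ⊥
    second-neighbour-violates-convexity 0<ℓ i =
      <⇒≱ (*-monoˡ-<-pos (+ ℓ) {{positive 0<ℓ}}
            (product-bound (2≤bend i) (2≤bend (next i)) (2≤len (next i)) (2≤len i)))
          (0≤i-j⇒j≤i (subst (0ℤ ℤ.≤_) (second-neighbour-level i) (level-bound (next (next i)) i)))
      where
      2≤len : ∀ j → + 2 ℤ.≤ len j
      2≤len j = even∧positive⇒2≤ (len-even j) (len-positive j)
      2≤bend : ∀ j → + 2 ℤ.≤ bend j
      2≤bend j = even∧positive⇒2≤ (bend-even j) (bend-positive j)

corollary7p8 : (ℓ : ℕ) → 1 ≤ ℓ → (k : ℕ) → (v : Fin (suc k) → ℤ²) →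
                 Reflexive ℓ k v → ℓ % 2 ≡ 1
corollary7p8 ℓ 1≤ℓ k v R with ℓ % 2 in ℓ%2≡r | m%n<n ℓ 2
... | 1           | _                 = refl
... | 0           | _                 =
  ⊥-elim (ReflexivePolygon.second-neighbour-violates-convexity R 2∣ℓ (+<+ 1≤ℓ) zero)
  where 2∣ℓ : + 2 ∣ + ℓ
        2∣ℓ = ∣ᵤ⇒∣ (m%n≡0⇒n∣m ℓ 2 ℓ%2≡r)
... | suc (suc _) | ℕ.s≤s (ℕ.s≤s ())
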